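{- Let $Z=(U,\Omega,\mathcal{C})$ be a semi-multimatroid. The following are equivalent: (1) $Z$ is a multimatroid; (2) for every $S\in\mathcal{S}(\Omega)$ and $\omega\in\Omega$ with $\omega\cap S=\emptyset$, there is at most one $x\in\omega$ such that $Z[S\cup\{x\}]$ and $Z[S]$ have different circuit families; (3) for every $S\in\mathcal{S}(\Omega)$ and $\omega\in\Omega$ with $\omega\cap S=\emptyset$, there is at most one $x\in\omega$ with $n_Z(S\cup\{x\})\neq n_Z(S)$; (4) for every $S\in\mathcal{S}(\Omega)$ with $|S|=|\Omega|-1$, there is at most one $x\in\omega$ with $n_Z(S\cup\{x\})\neq n_Z(S)$, where $\omega$ is the unique skew class disjoint from $S$; (5) every minor of $Z$ of order one has at most one circuit.
   Context: A carrier is $(U,\Omega)$ with $\Omega$ a partition of finite $U$ into skew classes; a skew pair is a 2-subset of a skew class; transversals meet each class in exactly one element, subtransversals are subsets of transversals; $\mathcal{T}(\Omega)$, $\mathcal{S}(\Omega)$ denote these sets. A semi-multimatroid $Z=(U,\Omega,\mathcal{C})$ has circuits $\mathcal{C}\subseteq\mathcal{S}(\Omega)$ such that each $(T,\mathcal{C}\cap 2^T)$, $T\in\mathcal{T}(\Omega)$, is a matroid (by circuits); for $S\in\mathcal{S}(\Omega)$, $Z[S]$ is the matroid $(S,\mathcal{C}\cap 2^S)$ and $n_Z(S)$ its nullity. $Z$ is a multimatroid if for all $C_1,C_2\in\mathcal{C}$, $C_1\cup C_2$ does not contain exactly one skew pair. The order of $Z$ is $|\Omega|$. For $X\in\mathcal{S}(\Omega)$,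 the minor $Z|X$ is the semi-multimatroid with skew classes $\Omega'=\{\omega:\omega\cap X=\emptyset\}$, ground set $\bigcup\Omega'$, and circuits those $C\in\mathcal{S}(\Omega')$ that are circuits of the matroid $Z[T\cup X]/X$ for some $T\in\mathcal{T}(\Omega')$. -}

module Defs where

open import Data.Nat using (ℕ; zero; suc; _∸_; _⊔_)
open import Data.Bool using (Bool; true; false; _∧_; not; if_then_else_)
open import Data.Fin using (Fin)
open import Data.Fin.Subset using (Subset; _∈_; _⊆_; _∪_; _─_; _-_; ∣_∣; Nonempty; ⊥; ⁅_⁆; inside; outside)
open import Data.Fin.Subset.Properties using (_⊆?_)
open import Data.List using (List; []; _∷_; _++_; map; foldr)
open import Data.Vec using (_∷_; [])
open import Data.Product using (Σ; ∃; ∃₂; _×_; _,_)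
open import Data.Sum using (_⊎_)
open import Relation.Nullary using (¬_; does)
open import Relation.Binary.PropositionalEquality using (_≡_; _≢_)
open import Function.Bundles using (_⇔_)

-- Carrier: finite ground set U = Fin n, partitioned into k skew classes.
-- The partition Ω is encoded by a labelling  cls : Fin n → Fin k  that is
-- surjective (so every skew class  { x | cls x ≡ j }  is nonempty).

Surjective : ∀ {n k} → (Fin n → Fin k) → Set
Surjective {n} {k} cls = ∀ (j : Fin k) → ∃ λ (x : Fin n) → cls x ≡ j

module _ {n k : ℕ} (cls : Fin n → Fin k) where

  SubTransversal : Subset n → Set
  SubTransversal S = ∀ x y → x ∈ S → y ∈ S → cls x ≡ cls y → x ≡ y

  Transversal : Subset n → Set
  Transversal T = SubTransversal T × (∀ (j : Fin k) → ∃ λ x → x ∈ T × cls x ≡ j)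

  ClassDisjoint : Subset n → Fin k → Set
  ClassDisjoint X j = ∀ y → y ∈ X → cls y ≢ j

  SkewPairIn : Subset n → Fin n → Fin n → Set
  SkewPairIn A x y = x ≢ y × cls x ≡ cls y × x ∈ A × y ∈ A

  ExactlyOneSkewPair : Subset n → Set
  ExactlyOneSkewPair A =
    ∃₂ λ x y → SkewPairIn A x y ×
      (∀ u v → SkewPairIn A u v → (u ≡ x × v ≡ y) ⊎ (u ≡ y × v ≡ x))

-- Matroids given by their circuits (a family of subsets of Fin n;
-- the ground set is implicit: it contains all the circuits).

record IsMatroidByCircuits {n : ℕ} (Circ : Subset n → Set) : Set where
  field
    empty-not-circuit : ¬ Circ ⊥
    incomparable      : ∀ A B → Circ A → Circ B → A ⊆ B → A ≡ B
    elimination       : ∀ A B → Circ A → Circ B → A ≢ B →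
                        ∀ e → e ∈ A → e ∈ B →
                        ∃ λ D → Circ D × D ⊆ ((A ∪ B) - e)

record SemiMultimatroid {n k : ℕ} (cls : Fin n → Fin k) : Set where
  field
    circuit    : Subset n → Bool
    circ-sub   : ∀ C → circuit C ≡ true → SubTransversal cls C
    transv-mat : ∀ T → Transversal cls T →
                 IsMatroidByCircuits (λ C → circuit C ≡ true × C ⊆ T)

module _ {n k : ℕ} {cls : Fin n → Fin k} (Z : SemiMultimatroid cls) where
  open SemiMultimatroid Z

  -- circuits of the matroid Z[S]  (i.e. 𝒞 ∩ 2^S)
  CircOf : Subset n → Subset n → Set
  CircOf S C = circuit C ≡ true × C ⊆ S

  IsMultimatroid : Set
  IsMultimatroid = ∀ C₁ C₂ → circuit C₁ ≡ true → circuit C₂ ≡ true →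
                   ¬ ExactlyOneSkewPair cls (C₁ ∪ C₂)

  CircuitsDiffer : Subset n → Fin n → Set
  CircuitsDiffer S x = ¬ (∀ C → CircOf (S ∪ ⁅ x ⁆) C ⇔ CircOf S C)

-- Nullity of Z[S]:  |S| - r(S),  r(S) = max size of an independent
-- subset of S (a set containing no circuit).

allSubsets : ∀ n → List (Subset n)
allSubsets zero    = [] ∷ []
allSubsets (suc n) = map (inside ∷_) (allSubsets n) ++ map (outside ∷_) (allSubsets n)

module _ {n k : ℕ} {cls : Fin n → Fin k} (Z : SemiMultimatroid cls) where
  open SemiMultimatroid Z

  independentᵇ : Subset n → Bool
  independentᵇ I = foldr (λ C b → not (does (C ⊆? I) ∧ circuit C) ∧ b) true (allSubsets n)

  rank : Subset n → ℕ
  rank S = foldr (λ I m → if independentᵇ I ∧ does (I ⊆? S) then ∣ I ∣ ⊔ m else m)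
                 0 (allSubsets n)

  nullity : Subset n → ℕ
  nullity S = ∣ S ∣ ∸ rank S

module _ {n k : ℕ} {cls : Fin n → Fin k} (Z : SemiMultimatroid cls) where
  open SemiMultimatroid Z

  -- T is a transversal of Ω' = { ω ∈ Ω | ω ∩ X = ∅ }
  TransversalAway : Subset n → Subset n → Set
  TransversalAway X T =
    (∀ x → x ∈ T → ClassDisjoint cls X (cls x)) ×
    SubTransversal cls T ×
    (∀ j → ClassDisjoint cls X j → ∃ λ x → x ∈ T × cls x ≡ j)

  -- D is a circuit of M / X, where M has circuit family Circ:
  -- a minimal nonempty set among { C ─ X | C circuit of M }.
  ContractionCircuit : (Subset n → Set) → Subset n → Subset n → Set
  ContractionCircuit Circ X D =
    Nonempty D ×
    (∃ λ C → Circ C × D ≡ C ─ X) ×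
    (∀ C → Circ C → Nonempty (C ─ X) → (C ─ X) ⊆ D → (C ─ X) ≡ D)

  MinorCircuit : Subset n → Subset n → Set
  MinorCircuit X D =
    SubTransversal cls D ×
    (∀ x → x ∈ D → ClassDisjoint cls X (cls x)) ×
    (∃ λ T → TransversalAway X T ×
             ContractionCircuit (CircOf Z (T ∪ X)) X D)

  MinorOrderOne : Subset n → Set
  MinorOrderOne X = ∃ λ j → ClassDisjoint cls X j ×
                            (∀ j' → ClassDisjoint cls X j' → j' ≡ j)

-- Say that a subtransversal S spans x (with x in a class disjoint from S) if some circuit
-- C ⊆ S ∪ {x} contains x. Z is a multimatroid iff no S spans two distinct elements x, y of one
-- class: circuits through x and through y have a union whose only skew pair is {x, y}, and
-- conversely if C₁ ∪ C₂ has exactly one skew pair {x, y}, then (C₁ ∪ C₂) − {x, y} spans both.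
-- As spanning is monotone in S, S may be enlarged to meet every class except that of x.
-- Conditions (2)–(5) are this criterion in disguise: Z[S ∪ {x}] has a new circuit iff S spans x;
-- n(S ∪ {x}) ≠ n(S) iff S spans x, where r(S ∪ {x}) = r(S) in the spanned case comes from
-- circuit exchange (via strong circuit elimination) in a transversal containing S ∪ {x}; and
-- the circuits of an order-one minor Z|X are exactly the singletons {y} with X spanning y.

module Submission where

open import Defs
open import Data.Bool using (Bool; true; false; T; _∧_; not; if_then_else_) renaming (_≟_ to _≟ᵇ_)
open import Data.Bool.Properties using (T-∧; T-≡)
open import Data.Empty using (⊥-elim)
open import Data.Fin using (Fin; zero; suc)
open import Data.Fin.Properties using (any?; all?; suc-injective; 0≢1+n; ¬Fin0) renaming (_≟_ to _≟ᶠ_)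
open import Data.Fin.Subset
  using (Subset; _∈_; _∉_; _⊆_; _∪_; _─_; _-_; ∣_∣; Nonempty; ⊥; ⊤; ⁅_⁆; inside; outside)
open import Data.Fin.Subset.Properties
  using (_⊆?_; _∈?_; anySubset?; x∈⁅x⁆; x∈⁅y⁆⇒x≡y; ⊆-antisym; ∈⊤; ∣⊤∣≡n; ∣⊥∣≡0; Empty-unique; ∉⊥;
         x∈p∪q⁻; x∈p∪q⁺; x∈p∧x∉q⇒x∈p─q; x∈p∧x≢y⇒x∈p-y; p─q⊆p; p⊆q⇒∣p∣≤∣q∣; p⊂q⇒∣p∣<∣q∣;
         ∪-identityʳ; ∪-comm; p⊆p∪q; q⊆p∪q)
open import Data.List using (List; []; _∷_; map; foldr)
open import Data.List.Membership.Propositional using () renaming (_∈_ to _∈ˡ_)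
open import Data.List.Membership.Propositional.Properties using (∈-map⁺; ∈-++⁺ˡ; ∈-++⁺ʳ)
open import Data.List.Relation.Unary.Any using () renaming (here to hereˡ; there to thereˡ)
open import Data.Nat using (ℕ; zero; suc; _+_; _∸_; _⊔_; _≤_; _<_; z≤n; s≤s)
open import Data.Nat.Properties
  using (≤-refl; ≤-trans; ≤-antisym; ≤-reflexive; <-≤-trans; n≤1+n; ⊔-lub; m≤m⊔n; m≤n⊔m; ⊔-sel;
         +-comm; +-∸-assoc; ∸-monoʳ-≤; >⇒≢; n<1+n; module ≤-Reasoning)
open import Data.Product using (∃; ∃₂; _×_; _,_; proj₁; proj₂)
open import Data.Sum using (_⊎_; inj₁; inj₂; [_,_]; map₂; swap)
open import Data.Unit using (tt)
open import Data.Vec using (_∷_; []; tabulate; here; there)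
open import Data.Vec.Properties using (lookup∘tabulate; []=⇒lookup; lookup⇒[]=)
open import Function.Base using (_∘_; id)
open import Function.Bundles using (_⇔_; mk⇔; Equivalence)
open import Relation.Nullary using (¬_; Dec; yes; no; does; contradiction)
open import Relation.Nullary.Decidable using (_×-dec_; ¬?; _→-dec_; decidable-stable)
open import Relation.Binary.PropositionalEquality using (_≡_; _≢_; refl; sym; trans; cong; cong₂; subst)

variable
  n k : ℕ

T-does⁺ : ∀ {P : Set} (d : Dec P) → P → T (does d)
T-does⁺ (yes _) _ = tt
T-does⁺ (no ¬p) p = ¬p p

T-does⁻ : ∀ {P : Set} (d : Dec P) → T (does d) → P
T-does⁻ (yes p) _ = p

module _ {A : Set} where

  T-foldr-∧⁻ : ∀ (f : A → Bool) {a} L → T (foldr (λ x b → f x ∧ b) true L) → a ∈ˡ L → T (f a)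
  T-foldr-∧⁻ f (x ∷ L) t (hereˡ refl)  = proj₁ (Equivalence.to T-∧ t)
  T-foldr-∧⁻ f (x ∷ L) t (thereˡ a∈L) = T-foldr-∧⁻ f L (proj₂ (Equivalence.to T-∧ t)) a∈L

  T-foldr-∧⁺ : ∀ (f : A → Bool) L → (∀ {a} → a ∈ˡ L → T (f a)) → T (foldr (λ x b → f x ∧ b) true L)
  T-foldr-∧⁺ f []      _   = tt
  T-foldr-∧⁺ f (x ∷ L) all = Equivalence.from T-∧ (all (hereˡ refl) , T-foldr-∧⁺ f L (λ a∈L → all (thereˡ a∈L)))

  module _ (b : A → Bool) (s : A → ℕ) where

    maxOver : List A → ℕ
    maxOver = foldr (λ a m → if b a then s a ⊔ m else m) 0

    maxOver-upper : ∀ {a} L → a ∈ˡ L → T (b a) → s a ≤ maxOver L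
    maxOver-upper {a} (x ∷ L) (hereˡ refl) ba with b a
    ... | true = m≤m⊔n (s a) (maxOver L)
    maxOver-upper (x ∷ L) (thereˡ a∈L) ba with b x
    ... | true  = ≤-trans (maxOver-upper L a∈L ba) (m≤n⊔m (s x) (maxOver L))
    ... | false = maxOver-upper L a∈L ba

    maxOver-least : ∀ {m} L → (∀ a → T (b a) → s a ≤ m) → maxOver L ≤ m
    maxOver-least []      _     = z≤n
    maxOver-least (x ∷ L) bound with b x in bx
    ... | true  = ⊔-lub (bound x (subst T (sym bx) tt)) (maxOver-least L bound)
    ... | false = maxOver-least L bound

    maxOver-attained : ∀ L → maxOver L ≡ 0 ⊎ ∃ λ a → T (b a) × s a ≡ maxOver L
    maxOver-attained []      = inj₁ refl
    maxOver-attained (x ∷ L) with b x in bx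
    ... | false = maxOver-attained L
    ... | true with ⊔-sel (s x) (maxOver L) | maxOver-attained L
    ...   | inj₁ ⊔≡sx | _                  = inj₂ (x , subst T (sym bx) tt , sym ⊔≡sx)
    ...   | inj₂ ⊔≡mL | inj₁ mL≡0          = inj₁ (trans ⊔≡mL mL≡0)
    ...   | inj₂ ⊔≡mL | inj₂ (a , ba , sa) = inj₂ (a , ba , trans sa (sym ⊔≡mL))

x∈p─q⇒x∉q : ∀ {x : Fin n} (p q : Subset n) → x ∈ p ─ q → x ∉ q
x∈p─q⇒x∉q (_ ∷ p) (_ ∷ q) (there x∈p─q) (there x∈q) = x∈p─q⇒x∉q p q x∈p─q x∈q

x∈p─q⁻ : ∀ {x : Fin n} (p q : Subset n) → x ∈ p ─ q → x ∈ p × x ∉ q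
x∈p─q⁻ p q x∈ = p─q⊆p p q x∈ , x∈p─q⇒x∉q p q x∈

x∈p-y⁻ : ∀ {x y : Fin n} (p : Subset n) → x ∈ p - y → x ∈ p × x ≢ y
x∈p-y⁻ {y = y} p x∈ = proj₁ (x∈p─q⁻ p ⁅ y ⁆ x∈) , λ { refl → x∈p─q⇒x∉q p ⁅ y ⁆ x∈ (x∈⁅x⁆ y) }

x∈p∪⁅y⁆⁻ : ∀ {x y : Fin n} (p : Subset n) → x ∈ p ∪ ⁅ y ⁆ → x ∈ p ⊎ x ≡ y
x∈p∪⁅y⁆⁻ {y = y} p x∈ with x∈p∪q⁻ p ⁅ y ⁆ x∈
... | inj₁ x∈p = inj₁ x∈p
... | inj₂ x∈y = inj₂ (x∈⁅y⁆⇒x≡y y x∈y)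

x∈p∪⁅y⁆∧x≢y⇒x∈p : ∀ {x y : Fin n} (p : Subset n) → x ∈ p ∪ ⁅ y ⁆ → x ≢ y → x ∈ p
x∈p∪⁅y⁆∧x≢y⇒x∈p p x∈ x≢y with x∈p∪⁅y⁆⁻ p x∈
... | inj₁ x∈p = x∈p
... | inj₂ x≡y = contradiction x≡y x≢y

y∈p∪⁅y⁆ : ∀ (p : Subset n) y → y ∈ p ∪ ⁅ y ⁆
y∈p∪⁅y⁆ p y = x∈p∪q⁺ (inj₂ (x∈⁅x⁆ y))

p⊆p∪⁅y⁆ : ∀ (p : Subset n) {y} → p ⊆ p ∪ ⁅ y ⁆
p⊆p∪⁅y⁆ p x∈p = x∈p∪q⁺ (inj₁ x∈p)

p≡⁅x⁆ : ∀ {p : Subset n} {x} → x ∈ p → (∀ {y} → y ∈ p → y ≡ x) → p ≡ ⁅ x ⁆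
p≡⁅x⁆ {p = p} {x} x∈p only-x =
  ⊆-antisym (λ y∈p → subst (_∈ ⁅ x ⁆) (sym (only-x y∈p)) (x∈⁅x⁆ x))
            (λ y∈x → subst (_∈ p) (sym (x∈⁅y⁆⇒x≡y x y∈x)) x∈p)

⁅⁆-injective : ∀ {x y : Fin n} → ⁅ x ⁆ ≡ ⁅ y ⁆ → x ≡ y
⁅⁆-injective {x = x} {y} x≡y = x∈⁅y⁆⇒x≡y y (subst (x ∈_) x≡y (x∈⁅x⁆ x))

x∈tabulate⁻ : ∀ (f : Fin n → Bool) {x} → x ∈ tabulate f → T (f x)
x∈tabulate⁻ f {x} x∈ = Equivalence.from T-≡ (trans (sym (lookup∘tabulate f x)) ([]=⇒lookup x∈))

x∈tabulate⁺ : ∀ (f : Fin n → Bool) {x} → T (f x) → x ∈ tabulate f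
x∈tabulate⁺ f {x} t = lookup⇒[]= x (tabulate f) (trans (lookup∘tabulate f x) (Equivalence.to T-≡ t))

p⊈q⇒∃x∈p∖q : ∀ (p q : Subset n) → ¬ p ⊆ q → ∃ λ x → x ∈ p × x ∉ q
p⊈q⇒∃x∈p∖q p q p⊈q with any? (λ x → (x ∈? p) ×-dec ¬? (x ∈? q))
... | yes x∈p∖q = x∈p∖q
... | no  ∄x    = ⊥-elim (p⊈q λ {x} x∈p → decidable-stable (x ∈? q) λ x∉q → ∄x (x , x∈p , x∉q))

p⊆r∧q⊆r⇒p∪q⊆r : ∀ {p q r : Subset n} → p ⊆ r → q ⊆ r → p ∪ q ⊆ r
p⊆r∧q⊆r⇒p∪q⊆r {p = p} {q} p⊆r q⊆r x∈ with x∈p∪q⁻ p q x∈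
... | inj₁ x∈p = p⊆r x∈p
... | inj₂ x∈q = q⊆r x∈q

p⊆q-x⇒p⊆q : ∀ {p q : Subset n} {x} → p ⊆ q - x → p ⊆ q
p⊆q-x⇒p⊆q {q = q} p⊆ x∈p = proj₁ (x∈p-y⁻ q (p⊆ x∈p))

p⊆q-x⇒x∉p : ∀ {p q : Subset n} {x} → p ⊆ q - x → x ∉ p
p⊆q-x⇒x∉p {q = q} p⊆ x∈p = proj₂ (x∈p-y⁻ q (p⊆ x∈p)) refl

p⊆q-x∧q⊆r⇒p⊆r-x : ∀ {p q r : Subset n} {x} → p ⊆ q - x → q ⊆ r → p ⊆ r - x
p⊆q-x∧q⊆r⇒p⊆r-x {q = q} p⊆q-x q⊆r y∈p with x∈p-y⁻ q (p⊆q-x y∈p)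
... | y∈q , y≢x = x∈p∧x≢y⇒x∈p-y (q⊆r y∈q) y≢x

p⊆q⇒p∪⁅x⁆⊆q∪⁅x⁆ : ∀ {p q : Subset n} {x} → p ⊆ q → p ∪ ⁅ x ⁆ ⊆ q ∪ ⁅ x ⁆
p⊆q⇒p∪⁅x⁆⊆q∪⁅x⁆ {p = p} {q} {x} p⊆q y∈ with x∈p∪⁅y⁆⁻ p y∈
... | inj₁ y∈p = p⊆p∪⁅y⁆ q (p⊆q y∈p)
... | inj₂ refl = y∈p∪⁅y⁆ q x

∣p∪⁅x⁆∣≡1+∣p∣ : ∀ (p : Subset n) {x} → x ∉ p → ∣ p ∪ ⁅ x ⁆ ∣ ≡ suc ∣ p ∣
∣p∪⁅x⁆∣≡1+∣p∣ (outside ∷ p) {zero}  _   = cong (λ q → suc ∣ q ∣) (∪-identityʳ p)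
∣p∪⁅x⁆∣≡1+∣p∣ (inside  ∷ p) {zero}  x∉p = contradiction here x∉p
∣p∪⁅x⁆∣≡1+∣p∣ (inside  ∷ p) {suc x} x∉p = cong suc (∣p∪⁅x⁆∣≡1+∣p∣ p (λ x∈p → x∉p (there x∈p)))
∣p∪⁅x⁆∣≡1+∣p∣ (outside ∷ p) {suc x} x∉p = ∣p∪⁅x⁆∣≡1+∣p∣ p (λ x∈p → x∉p (there x∈p))

1+∣p-x∣≡∣p∣ : ∀ (p : Subset n) {x} → x ∈ p → suc ∣ p - x ∣ ≡ ∣ p ∣
1+∣p-x∣≡∣p∣ p {x} x∈p = trans (sym (∣p∪⁅x⁆∣≡1+∣p∣ (p - x) (λ x∈p-x → proj₂ (x∈p-y⁻ p x∈p-x) refl)))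
                                (cong ∣_∣ (⊆-antisym ⊆p ⊇p))
  where
  ⊆p : (p - x) ∪ ⁅ x ⁆ ⊆ p
  ⊆p y∈ with x∈p∪⁅y⁆⁻ (p - x) y∈
  ... | inj₁ y∈p-x = proj₁ (x∈p-y⁻ p y∈p-x)
  ... | inj₂ refl  = x∈p
  ⊇p : p ⊆ (p - x) ∪ ⁅ x ⁆
  ⊇p {y} y∈p with y ≟ᶠ x
  ... | yes refl = y∈p∪⁅y⁆ (p - x) y
  ... | no  y≢x  = p⊆p∪⁅y⁆ (p - x) (x∈p∧x≢y⇒x∈p-y y∈p y≢x)

∣p∣≤1+∣p-x∣ : ∀ (p : Subset n) x → ∣ p ∣ ≤ suc ∣ p - x ∣
∣p∣≤1+∣p-x∣ p x with x ∈? p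
... | yes x∈p = ≤-reflexive (sym (1+∣p-x∣≡∣p∣ p x∈p))
... | no  x∉p = ≤-trans (p⊆q⇒∣p∣≤∣q∣ p⊆p-x) (n≤1+n _)
  where
  p⊆p-x : p ⊆ p - x
  p⊆p-x y∈p = x∈p∧x≢y⇒x∈p-y y∈p λ { refl → x∉p y∈p }

subTransversal-tail : ∀ {f : Fin (suc n) → Fin k} {s p} → SubTransversal f (s ∷ p) → SubTransversal (f ∘ suc) p
subTransversal-tail inj x y x∈p y∈p fx≡fy = suc-injective (inj (suc x) (suc y) (there x∈p) (there y∈p) fx≡fy)

∣p∣≡∣q∣-if-bijectiveOn : ∀ (f : Fin n → Fin k) (p : Subset n) (q : Subset k) → SubTransversal f p →
                         (∀ {x} → x ∈ p → f x ∈ q) → (∀ {j} → j ∈ q → ∃ λ x → x ∈ p × f x ≡ j) →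
                         ∣ p ∣ ≡ ∣ q ∣
∣p∣≡∣q∣-if-bijectiveOn {k = k} f [] q _ _ onto =
  sym (trans (cong ∣_∣ (Empty-unique λ { (j , j∈q) → ¬Fin0 (proj₁ (onto j∈q)) })) (∣⊥∣≡0 k))
∣p∣≡∣q∣-if-bijectiveOn f (outside ∷ p) q inj into onto =
  ∣p∣≡∣q∣-if-bijectiveOn (f ∘ suc) p q
    (subTransversal-tail inj) (λ x∈p → into (there x∈p)) onto′
  where
  onto′ : ∀ {j} → j ∈ q → ∃ λ x → x ∈ p × f (suc x) ≡ j
  onto′ j∈q with onto j∈q
  ... | suc x , there x∈p , fx≡j = x , x∈p , fx≡j
∣p∣≡∣q∣-if-bijectiveOn f (inside ∷ p) q inj into onto =
  trans (cong suc (∣p∣≡∣q∣-if-bijectiveOn (f ∘ suc) p (q - f zero)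
                     (subTransversal-tail inj) into′ onto′))
        (1+∣p-x∣≡∣p∣ q (into here))
  where
  into′ : ∀ {x} → x ∈ p → f (suc x) ∈ q - f zero
  into′ x∈p = x∈p∧x≢y⇒x∈p-y (into (there x∈p)) (λ e → 0≢1+n (inj zero _ here (there x∈p) (sym e)))
  onto′ : ∀ {j} → j ∈ q - f zero → ∃ λ x → x ∈ p × f (suc x) ≡ j
  onto′ j∈ with x∈p-y⁻ q j∈
  ... | j∈q , j≢f0 with onto j∈q
  ... | zero  , _          , f0≡j = contradiction (sym f0≡j) j≢f0
  ... | suc x , there x∈p , fx≡j = x , x∈p , fx≡j

allSubsets-complete : ∀ (p : Subset n) → p ∈ˡ allSubsets n
allSubsets-complete [] = hereˡ refl
allSubsets-complete {suc n} (inside ∷ p) = ∈-++⁺ˡ (∈-map⁺ (inside ∷_) (allSubsets-complete p))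
allSubsets-complete {suc n} (outside ∷ p) =
  ∈-++⁺ʳ (map (inside ∷_) (allSubsets n)) (∈-map⁺ (outside ∷_) (allSubsets-complete p))

Independent : (Subset n → Set) → Subset n → Set
Independent Circ I = ∀ C → Circ C → ¬ C ⊆ I

module CircuitMatroid {Circ : Subset n → Set} (circ? : ∀ C → Dec (Circ C)) (M : IsMatroidByCircuits Circ) where
  open IsMatroidByCircuits M

  independent-or-circuit⊆ : ∀ J → Independent Circ J ⊎ ∃ λ D → Circ D × D ⊆ J
  independent-or-circuit⊆ J with anySubset? {P = λ C → Circ C × C ⊆ J} (λ C → circ? C ×-dec (C ⊆? J))
  ... | yes D⊆J = inj₂ D⊆J
  ... | no  ∄D  = inj₁ λ C cC C⊆J → ∄D (C , cC , C⊆J)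

  distinct-circuits-⊈ : ∀ {A B} → Circ A → Circ B → A ≢ B → ∃ λ x → x ∈ A × x ∉ B
  distinct-circuits-⊈ {A} {B} cA cB A≢B = p⊈q⇒∃x∈p∖q A B (λ A⊆B → A≢B (incomparable A B cA cB A⊆B))

  strong-elimination : ∀ {A B e f} → Circ A → Circ B → A ≢ B → e ∈ A → e ∈ B → f ∈ A → f ∉ B →
                       ∃ λ D → Circ D × D ⊆ (A ∪ B) - e × f ∈ D
  strong-elimination {A} {B} = bounded (suc ∣ A ∪ B ∣) ≤-refl
    where
    bounded : ∀ m {A B e f} → ∣ A ∪ B ∣ < m → Circ A → Circ B → A ≢ B → e ∈ A → e ∈ B → f ∈ A → f ∉ B →
              ∃ λ D → Circ D × D ⊆ (A ∪ B) - e × f ∈ D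
    bounded zero ()
    bounded (suc m) {A} {B} {e} {f} (s≤s ∣A∪B∣≤m) cA cB A≢B e∈A e∈B f∈A f∉B
      with elimination A B cA cB A≢B e e∈A e∈B
    ... | C , cC , C⊆A∪B-e with f ∈? C
    ... | yes f∈C = C , cC , C⊆A∪B-e , f∈C
    ... | no  f∉C with distinct-circuits-⊈ cC cA (λ C≡A → p⊆q-x⇒x∉p C⊆A∪B-e (subst (e ∈_) (sym C≡A) e∈A))
    ... | g , g∈C , g∉A = eliminate-e (bounded m (<-≤-trans ∣B∪C∣<∣A∪B∣ ∣A∪B∣≤m) cB cC B≢C g∈B g∈C e∈B e∉C)
      where
      -- eliminate g ∈ C ─ A from B and C keeping e, then e from A and the result keeping f
      e∉C = p⊆q-x⇒x∉p C⊆A∪B-e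
      C⊆A∪B = p⊆q-x⇒p⊆q C⊆A∪B-e
      B≢C : B ≢ C
      B≢C B≡C = e∉C (subst (e ∈_) B≡C e∈B)
      g∈B : g ∈ B
      g∈B with x∈p∪q⁻ A B (C⊆A∪B g∈C)
      ... | inj₁ g∈A = contradiction g∈A g∉A
      ... | inj₂ g∈B = g∈B
      B∪C⊆A∪B : B ∪ C ⊆ A ∪ B
      B∪C⊆A∪B = p⊆r∧q⊆r⇒p∪q⊆r (λ x∈B → x∈p∪q⁺ (inj₂ x∈B)) C⊆A∪B
      f∉B∪C : f ∉ B ∪ C
      f∉B∪C f∈ with x∈p∪q⁻ B C f∈
      ... | inj₁ f∈B = f∉B f∈B
      ... | inj₂ f∈C = f∉C f∈C
      ∣B∪C∣<∣A∪B∣ : ∣ B ∪ C ∣ < ∣ A ∪ B ∣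
      ∣B∪C∣<∣A∪B∣ = p⊂q⇒∣p∣<∣q∣ (B∪C⊆A∪B , f , x∈p∪q⁺ (inj₁ f∈A) , f∉B∪C)
      eliminate-e : (∃ λ C′ → Circ C′ × C′ ⊆ (B ∪ C) - g × e ∈ C′) → ∃ λ D → Circ D × D ⊆ (A ∪ B) - e × f ∈ D
      eliminate-e (C′ , cC′ , C′⊆B∪C-g , e∈C′) =
        widen (bounded m (<-≤-trans ∣A∪C′∣<∣A∪B∣ ∣A∪B∣≤m) cA cC′ A≢C′ e∈A e∈C′ f∈A f∉C′)
        where
        f∉C′ : f ∉ C′
        f∉C′ f∈C′ = f∉B∪C (p⊆q-x⇒p⊆q C′⊆B∪C-g f∈C′)
        A≢C′ : A ≢ C′
        A≢C′ A≡C′ = f∉C′ (subst (f ∈_) A≡C′ f∈A)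
        A∪C′⊆A∪B : A ∪ C′ ⊆ A ∪ B
        A∪C′⊆A∪B = p⊆r∧q⊆r⇒p∪q⊆r (λ x∈A → x∈p∪q⁺ (inj₁ x∈A))
                                   (λ x∈C′ → B∪C⊆A∪B (p⊆q-x⇒p⊆q C′⊆B∪C-g x∈C′))
        g∉A∪C′ : g ∉ A ∪ C′
        g∉A∪C′ g∈ with x∈p∪q⁻ A C′ g∈
        ... | inj₁ g∈A  = g∉A g∈A
        ... | inj₂ g∈C′ = p⊆q-x⇒x∉p C′⊆B∪C-g g∈C′
        ∣A∪C′∣<∣A∪B∣ : ∣ A ∪ C′ ∣ < ∣ A ∪ B ∣
        ∣A∪C′∣<∣A∪B∣ = p⊂q⇒∣p∣<∣q∣ (A∪C′⊆A∪B , g , x∈p∪q⁺ (inj₂ g∈B) , g∉A∪C′)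
        widen : (∃ λ D → Circ D × D ⊆ (A ∪ C′) - e × f ∈ D) → ∃ λ D → Circ D × D ⊆ (A ∪ B) - e × f ∈ D
        widen (D , cD , D⊆A∪C′-e , f∈D) = D , cD , p⊆q-x∧q⊆r⇒p⊆r-x D⊆A∪C′-e A∪C′⊆A∪B , f∈D

  exchange : ∀ {I K C y} → Independent Circ I → I ⊆ K → y ∈ I → Circ C → C ⊆ K → y ∈ C →
             ∃ λ e → e ∈ K × e ∉ I × Independent Circ ((I - y) ∪ ⁅ e ⁆)
  exchange {I} {K} {C} {y} indI I⊆K y∈I = bounded (suc ∣ C ─ I ∣) ≤-refl
    where
    bounded : ∀ m {C} → ∣ C ─ I ∣ < m → Circ C → C ⊆ K → y ∈ C →
              ∃ λ e → e ∈ K × e ∉ I × Independent Circ ((I - y) ∪ ⁅ e ⁆)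
    bounded zero ()
    bounded (suc m) {C} (s≤s ∣C─I∣≤m) cC C⊆K y∈C with p⊈q⇒∃x∈p∖q C I (indI C cC)
    ... | e , e∈C , e∉I with independent-or-circuit⊆ ((I - y) ∪ ⁅ e ⁆)
    ... | inj₁ indJ = e , C⊆K e∈C , e∉I , indJ
    ... | inj₂ (D , cD , D⊆J) = recurse (strong-elimination cC cD C≢D e∈C e∈D y∈C y∉D)
      where
      -- eliminating e from C and D keeping y gives a circuit through y with smaller C ─ I
      D⊆I∪e : D ⊆ I ∪ ⁅ e ⁆
      D⊆I∪e x∈D with x∈p∪⁅y⁆⁻ (I - y) (D⊆J x∈D)
      ... | inj₁ x∈I-y = p⊆p∪⁅y⁆ I (proj₁ (x∈p-y⁻ I x∈I-y))
      ... | inj₂ refl  = y∈p∪⁅y⁆ I e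
      e∈D : e ∈ D
      e∈D with e ∈? D
      ... | yes e∈D = e∈D
      ... | no  e∉D = ⊥-elim (indI D cD λ x∈D →
                        x∈p∪⁅y⁆∧x≢y⇒x∈p I (D⊆I∪e x∈D) (λ { refl → e∉D x∈D }))
      y∉D : y ∉ D
      y∉D y∈D with x∈p∪⁅y⁆⁻ (I - y) (D⊆J y∈D)
      ... | inj₁ y∈I-y = proj₂ (x∈p-y⁻ I y∈I-y) refl
      ... | inj₂ refl  = e∉I y∈I
      C≢D : C ≢ D
      C≢D C≡D = y∉D (subst (y ∈_) C≡D y∈C)
      I∪e⊆K : I ∪ ⁅ e ⁆ ⊆ K
      I∪e⊆K = p⊆r∧q⊆r⇒p∪q⊆r I⊆K λ x∈e → subst (_∈ K) (sym (x∈⁅y⁆⇒x≡y e x∈e)) (C⊆K e∈C)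
      C∪D⊆K : C ∪ D ⊆ K
      C∪D⊆K = p⊆r∧q⊆r⇒p∪q⊆r C⊆K λ x∈D → I∪e⊆K (D⊆I∪e x∈D)
      recurse : (∃ λ D′ → Circ D′ × D′ ⊆ (C ∪ D) - e × y ∈ D′) →
                ∃ λ e → e ∈ K × e ∉ I × Independent Circ ((I - y) ∪ ⁅ e ⁆)
      recurse (D′ , cD′ , D′⊆C∪D-e , y∈D′) =
        bounded m (<-≤-trans ∣D′─I∣<∣C─I∣ ∣C─I∣≤m) cD′
                (λ x∈D′ → C∪D⊆K (p⊆q-x⇒p⊆q D′⊆C∪D-e x∈D′)) y∈D′
        where
        D′─I⊆C─I : D′ ─ I ⊆ C ─ I
        D′─I⊆C─I x∈ with x∈p─q⁻ D′ I x∈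
        ... | x∈D′ , x∉I with x∈p-y⁻ (C ∪ D) (D′⊆C∪D-e x∈D′)
        ... | x∈C∪D , x≢e with x∈p∪q⁻ C D x∈C∪D
        ... | inj₁ x∈C = x∈p∧x∉q⇒x∈p─q x∈C x∉I
        ... | inj₂ x∈D = contradiction (x∈p∪⁅y⁆∧x≢y⇒x∈p I (D⊆I∪e x∈D) x≢e) x∉I
        ∣D′─I∣<∣C─I∣ : ∣ D′ ─ I ∣ < ∣ C ─ I ∣
        ∣D′─I∣<∣C─I∣ = p⊂q⇒∣p∣<∣q∣ (D′─I⊆C─I , e , x∈p∧x∉q⇒x∈p─q e∈C e∉I ,
                                     λ e∈D′─I → p⊆q-x⇒x∉p D′⊆C∪D-e (proj₁ (x∈p─q⁻ D′ I e∈D′─I)))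

module Rank {cls : Fin n → Fin k} (Z : SemiMultimatroid cls) where
  open SemiMultimatroid Z

  Circuit : Subset n → Set
  Circuit C = circuit C ≡ true

  independentᵇ-sound : ∀ I → T (independentᵇ Z I) → Independent Circuit I
  independentᵇ-sound I t C cC C⊆I
    with C ⊆? I | T-foldr-∧⁻ (λ D → not (does (D ⊆? I) ∧ circuit D)) (allSubsets n) t (allSubsets-complete C)
  ... | yes _   | t′ = subst (λ b → T (not b)) cC t′
  ... | no C⊈I | _  = C⊈I C⊆I

  independentᵇ-complete : ∀ I → Independent Circuit I → T (independentᵇ Z I)
  independentᵇ-complete I indI = T-foldr-∧⁺ _ (allSubsets n) λ {C} _ → notCircuit⊆ C
    where
    notCircuit⊆ : ∀ C → T (not (does (C ⊆? I) ∧ circuit C))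
    notCircuit⊆ C with C ⊆? I | circuit C in cC
    ... | yes C⊆I | true  = indI C cC C⊆I
    ... | yes _   | false = tt
    ... | no  _   | _     = tt

  private
    admissible : Subset n → Subset n → Bool
    admissible S I = independentᵇ Z I ∧ does (I ⊆? S)

    admissible⁺ : ∀ {S I} → Independent Circuit I → I ⊆ S → T (admissible S I)
    admissible⁺ {S} {I} indI I⊆S with I ⊆? S
    ... | yes _    = Equivalence.from T-∧ (independentᵇ-complete I indI , tt)
    ... | no  I⊈S = ⊥-elim (I⊈S I⊆S)

    admissible⁻ : ∀ {S I} → T (admissible S I) → Independent Circuit I × I ⊆ S
    admissible⁻ {S} {I} t with I ⊆? S
    ... | yes I⊆S = independentᵇ-sound I (proj₁ (Equivalence.to T-∧ t)) , I⊆S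
    ... | no  _   = ⊥-elim (proj₂ (Equivalence.to T-∧ t))

  rank-upper : ∀ {S I} → Independent Circuit I → I ⊆ S → ∣ I ∣ ≤ rank Z S
  rank-upper {S} {I} indI I⊆S =
    maxOver-upper (admissible S) ∣_∣ (allSubsets n) (allSubsets-complete I) (admissible⁺ indI I⊆S)

  rank-least : ∀ {S m} → (∀ I → Independent Circuit I → I ⊆ S → ∣ I ∣ ≤ m) → rank Z S ≤ m
  rank-least {S} bound =
    maxOver-least (admissible S) ∣_∣ (allSubsets n) λ I t → bound I (proj₁ (admissible⁻ t)) (proj₂ (admissible⁻ t))

  rank-attained : ∀ S → Independent Circuit ⊥ → ∃ λ I → Independent Circuit I × I ⊆ S × ∣ I ∣ ≡ rank Z S
  rank-attained S ind⊥ with maxOver-attained (admissible S) ∣_∣ (allSubsets n)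
  ... | inj₁ rank≡0          = ⊥ , ind⊥ , (λ x∈⊥ → contradiction x∈⊥ ∉⊥) , trans (∣⊥∣≡0 n) (sym rank≡0)
  ... | inj₂ (I , t , ∣I∣≡) = I , proj₁ (admissible⁻ t) , proj₂ (admissible⁻ t) , ∣I∣≡

  rank≤∣S∣ : ∀ S → rank Z S ≤ ∣ S ∣
  rank≤∣S∣ S = rank-least λ I _ I⊆S → p⊆q⇒∣p∣≤∣q∣ I⊆S

module Spanning {cls : Fin n → Fin k} (Z : SemiMultimatroid cls) where
  open SemiMultimatroid Z
  open Rank Z

  Spans : Subset n → Fin n → Set
  Spans S x = ∃ λ C → CircOf Z (S ∪ ⁅ x ⁆) C × x ∈ C

  spans? : ∀ S x → Dec (Spans S x)
  spans? S x = anySubset? λ C → ((circuit C ≟ᵇ true) ×-dec (C ⊆? (S ∪ ⁅ x ⁆))) ×-dec (x ∈? C)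

  spans-mono : ∀ {S S′ x} → S ⊆ S′ → Spans S x → Spans S′ x
  spans-mono S⊆S′ (C , (cC , C⊆S∪x) , x∈C) = C , (cC , λ y∈C → p⊆q⇒p∪⁅x⁆⊆q∪⁅x⁆ S⊆S′ (C⊆S∪x y∈C)) , x∈C

  circuitsDiffer⇔spans : ∀ {S x} → x ∉ S → CircuitsDiffer Z S x ⇔ Spans S x
  circuitsDiffer⇔spans {S} {x} x∉S = mk⇔ differ⇒spans spans⇒differ
    where
    spans⇒differ : Spans S x → CircuitsDiffer Z S x
    spans⇒differ (C , circC , x∈C) same = x∉S (proj₂ (Equivalence.to (same C) circC) x∈C)
    differ⇒spans : CircuitsDiffer Z S x → Spans S x
    differ⇒spans differ with spans? S x
    ... | yes spans = spans
    ... | no ¬spans = ⊥-elim (differ λ C → mk⇔ (drop-x C) (λ (cC , C⊆S) → cC , λ y∈C → p⊆p∪⁅y⁆ S (C⊆S y∈C)))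
      where
      drop-x : ∀ C → CircOf Z (S ∪ ⁅ x ⁆) C → CircOf Z S C
      drop-x C (cC , C⊆S∪x) =
        cC , λ y∈C → x∈p∪⁅y⁆∧x≢y⇒x∈p S (C⊆S∪x y∈C) λ { refl → ¬spans (C , (cC , C⊆S∪x) , y∈C) }

  independent-⊥ : ∀ {T} → Transversal cls T → Independent Circuit ⊥
  independent-⊥ {T} hT C cC C⊆⊥ =
    IsMatroidByCircuits.empty-not-circuit (transv-mat T hT)
      (subst Circuit (Empty-unique λ (x , x∈C) → ∉⊥ (C⊆⊥ x∈C)) cC , λ x∈⊥ → contradiction x∈⊥ ∉⊥)

  rank-∪⁅⁆-unspanned : ∀ {S x} → Independent Circuit ⊥ → x ∉ S → ¬ Spans S x →
                       rank Z (S ∪ ⁅ x ⁆) ≡ suc (rank Z S)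
  rank-∪⁅⁆-unspanned {S} {x} ind⊥ x∉S ¬spans = ≤-antisym (rank-least bound) (base-extends (rank-attained S ind⊥))
    where
    bound : ∀ I → Independent Circuit I → I ⊆ S ∪ ⁅ x ⁆ → ∣ I ∣ ≤ suc (rank Z S)
    bound I indI I⊆S∪x = ≤-trans (∣p∣≤1+∣p-x∣ I x) (s≤s (rank-upper indI-x I-x⊆S))
      where
      indI-x : Independent Circuit (I - x)
      indI-x C cC C⊆I-x = indI C cC (p⊆q-x⇒p⊆q C⊆I-x)
      I-x⊆S : I - x ⊆ S
      I-x⊆S y∈I-x with x∈p-y⁻ I y∈I-x
      ... | y∈I , y≢x = x∈p∪⁅y⁆∧x≢y⇒x∈p S (I⊆S∪x y∈I) y≢x
    base-extends : (∃ λ I → Independent Circuit I × I ⊆ S × ∣ I ∣ ≡ rank Z S) → suc (rank Z S) ≤ rank Z (S ∪ ⁅ x ⁆)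
    base-extends (I , indI , I⊆S , ∣I∣≡r) =
      subst (_≤ rank Z (S ∪ ⁅ x ⁆)) (trans (∣p∪⁅x⁆∣≡1+∣p∣ I (λ x∈I → x∉S (I⊆S x∈I))) (cong suc ∣I∣≡r))
            (rank-upper indI∪x (p⊆q⇒p∪⁅x⁆⊆q∪⁅x⁆ I⊆S))
      where
      indI∪x : Independent Circuit (I ∪ ⁅ x ⁆)
      indI∪x C cC C⊆I∪x with x ∈? C
      ... | yes x∈C = ¬spans (C , (cC , λ y∈C → p⊆q⇒p∪⁅x⁆⊆q∪⁅x⁆ I⊆S (C⊆I∪x y∈C)) , x∈C)
      ... | no  x∉C = indI C cC λ y∈C → x∈p∪⁅y⁆∧x≢y⇒x∈p I (C⊆I∪x y∈C) λ { refl → x∉C y∈C }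

  rank-∪⁅⁆-spanned : ∀ {T S x} → Transversal cls T → S ∪ ⁅ x ⁆ ⊆ T → Spans S x →
                     rank Z (S ∪ ⁅ x ⁆) ≤ rank Z S
  rank-∪⁅⁆-spanned {T} {S} {x} hT S∪x⊆T (C , (cC , C⊆S∪x) , x∈C) = rank-least bound
    where
    open CircuitMatroid (λ D → (circuit D ≟ᵇ true) ×-dec (D ⊆? T)) (transv-mat T hT)
    bound : ∀ I → Independent Circuit I → I ⊆ S ∪ ⁅ x ⁆ → ∣ I ∣ ≤ rank Z S
    bound I indI I⊆S∪x with x ∈? I
    ... | no  x∉I = rank-upper indI λ y∈I → x∈p∪⁅y⁆∧x≢y⇒x∈p S (I⊆S∪x y∈I) λ { refl → x∉I y∈I }
    ... | yes x∈I with exchange (λ D (cD , _) → indI D cD) I⊆S∪x x∈I (cC , λ y∈C → S∪x⊆T (C⊆S∪x y∈C)) C⊆S∪x x∈C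
    ...   | e , e∈S∪x , e∉I , indJ = subst (_≤ rank Z S) ∣J∣≡∣I∣ (rank-upper indJ′ J⊆S)
      where
      -- J = (I - x) ∪ {e} is independent in the matroid Z[T], hence in Z since J ⊆ T
      J⊆S : (I - x) ∪ ⁅ e ⁆ ⊆ S
      J⊆S y∈J with x∈p∪⁅y⁆⁻ (I - x) y∈J
      ... | inj₁ y∈I-x = x∈p∪⁅y⁆∧x≢y⇒x∈p S (I⊆S∪x (proj₁ (x∈p-y⁻ I y∈I-x))) (proj₂ (x∈p-y⁻ I y∈I-x))
      ... | inj₂ refl  = x∈p∪⁅y⁆∧x≢y⇒x∈p S e∈S∪x λ { refl → e∉I x∈I }
      indJ′ : Independent Circuit ((I - x) ∪ ⁅ e ⁆)
      indJ′ D cD D⊆J = indJ D (cD , λ y∈D → S∪x⊆T (p⊆p∪⁅y⁆ S (J⊆S (D⊆J y∈D)))) D⊆J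
      ∣J∣≡∣I∣ : ∣ (I - x) ∪ ⁅ e ⁆ ∣ ≡ ∣ I ∣
      ∣J∣≡∣I∣ = trans (∣p∪⁅x⁆∣≡1+∣p∣ (I - x) (λ e∈I-x → e∉I (proj₁ (x∈p-y⁻ I e∈I-x))))
                      (1+∣p-x∣≡∣p∣ I x∈I)

  nullity-∪⁅⁆-unspanned : ∀ {S x} → Independent Circuit ⊥ → x ∉ S → ¬ Spans S x →
                          nullity Z (S ∪ ⁅ x ⁆) ≡ nullity Z S
  nullity-∪⁅⁆-unspanned {S} ind⊥ x∉S ¬spans =
    cong₂ _∸_ (∣p∪⁅x⁆∣≡1+∣p∣ S x∉S) (rank-∪⁅⁆-unspanned ind⊥ x∉S ¬spans)

  nullity-∪⁅⁆-spanned : ∀ {T S x} → Transversal cls T → S ∪ ⁅ x ⁆ ⊆ T → x ∉ S → Spans S x →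
                        nullity Z S < nullity Z (S ∪ ⁅ x ⁆)
  nullity-∪⁅⁆-spanned {T} {S} {x} hT S∪x⊆T x∉S spans = begin-strict
    ∣ S ∣ ∸ rank Z S                 <⟨ n<1+n _ ⟩
    suc (∣ S ∣ ∸ rank Z S)           ≡⟨ +-∸-assoc 1 (rank≤∣S∣ S) ⟨
    suc ∣ S ∣ ∸ rank Z S             ≤⟨ ∸-monoʳ-≤ (suc ∣ S ∣) (rank-∪⁅⁆-spanned hT S∪x⊆T spans) ⟩
    suc ∣ S ∣ ∸ rank Z (S ∪ ⁅ x ⁆)   ≡⟨ cong (_∸ rank Z (S ∪ ⁅ x ⁆)) (∣p∪⁅x⁆∣≡1+∣p∣ S x∉S) ⟨
    ∣ S ∪ ⁅ x ⁆ ∣ ∸ rank Z (S ∪ ⁅ x ⁆) ∎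
    where open ≤-Reasoning

module SkewClasses (cls : Fin n → Fin k) where

  classDisjoint⇒∉ : ∀ {S j x} → ClassDisjoint cls S j → cls x ≡ j → x ∉ S
  classDisjoint⇒∉ {x = x} disj cx≡j x∈S = disj x x∈S cx≡j

  transversal-size : ∀ {T} → Transversal cls T → ∣ T ∣ ≡ k
  transversal-size {T} (subT , onto) =
    trans (∣p∣≡∣q∣-if-bijectiveOn cls T ⊤ subT (λ _ → ∈⊤) (λ {j} _ → onto j)) (∣⊤∣≡n k)

  classDisjoint? : ∀ X j → Dec (ClassDisjoint cls X j)
  classDisjoint? X j with all? (λ y → (y ∈? X) →-dec ¬? (cls y ≟ᶠ j))
  ... | yes disj = yes λ y → disj y
  ... | no ¬disj = no λ disj → ¬disj λ y → disj y

  TransversalBut : Subset n → Fin k → Set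
  TransversalBut X j = SubTransversal cls X × ClassDisjoint cls X j × (∀ j′ → j′ ≢ j → ∃ λ x → x ∈ X × cls x ≡ j′)

  transversalBut-∪⁅⁆ : ∀ {X j x} → TransversalBut X j → cls x ≡ j → Transversal cls (X ∪ ⁅ x ⁆)
  transversalBut-∪⁅⁆ {X} {j} {x} (subX , disj , cover) cx≡j = sub , onto
    where
    sub : SubTransversal cls (X ∪ ⁅ x ⁆)
    sub u v u∈ v∈ cu≡cv with x∈p∪⁅y⁆⁻ X u∈ | x∈p∪⁅y⁆⁻ X v∈
    ... | inj₁ u∈X | inj₁ v∈X = subX u v u∈X v∈X cu≡cv
    ... | inj₁ u∈X | inj₂ refl = contradiction (trans cu≡cv cx≡j) (disj u u∈X)
    ... | inj₂ refl | inj₁ v∈X = contradiction (trans (sym cu≡cv) cx≡j) (disj v v∈X)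
    ... | inj₂ refl | inj₂ refl = refl
    onto : ∀ j′ → ∃ λ y → y ∈ X ∪ ⁅ x ⁆ × cls y ≡ j′
    onto j′ with j′ ≟ᶠ j
    ... | yes refl = x , y∈p∪⁅y⁆ X x , cx≡j
    ... | no j′≢j with cover j′ j′≢j
    ...   | y , y∈X , cy≡j′ = y , p⊆p∪⁅y⁆ X y∈X , cy≡j′

  transversalBut-size : ∀ {X j x} → TransversalBut X j → cls x ≡ j → ∣ X ∣ + 1 ≡ k
  transversalBut-size {X} tX@(_ , disjX , _) cx≡j =
    trans (+-comm ∣ X ∣ 1) (trans (sym (∣p∪⁅x⁆∣≡1+∣p∣ X (classDisjoint⇒∉ disjX cx≡j)))
                                  (transversal-size (transversalBut-∪⁅⁆ tX cx≡j)))

  transversalBut⇒minorOrderOne : ∀ {X j} (Z : SemiMultimatroid cls) → TransversalBut X j → MinorOrderOne Z X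
  transversalBut⇒minorOrderOne {X} {j} Z (_ , disj , cover) = j , disj , only-j
    where
    only-j : ∀ j′ → ClassDisjoint cls X j′ → j′ ≡ j
    only-j j′ disj′ with j′ ≟ᶠ j
    ... | yes j′≡j = j′≡j
    ... | no  j′≢j with cover j′ j′≢j
    ...   | y , y∈X , cy≡j′ = contradiction cy≡j′ (disj′ y y∈X)

  module _ (surj : Surjective cls) where

    private
      rep : Fin k → Fin n
      rep j = proj₁ (surj j)

      cls-rep : ∀ j → cls (rep j) ≡ j
      cls-rep j = proj₂ (surj j)

      Missing : Subset n → Fin k → Fin n → Set
      Missing S j x = cls x ≢ j × ClassDisjoint cls S (cls x) × x ≡ rep (cls x)

      missing? : ∀ S j x → Dec (Missing S j x)
      missing? S j x = ¬? (cls x ≟ᶠ j) ×-dec (classDisjoint? S (cls x) ×-dec (x ≟ᶠ rep (cls x)))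

    completeBut : Subset n → Fin k → Subset n
    completeBut S j = S ∪ tabulate (λ x → does (missing? S j x))

    completeBut-⊇ : ∀ S j → S ⊆ completeBut S j
    completeBut-⊇ S j x∈S = x∈p∪q⁺ (inj₁ x∈S)

    completeBut-transversalBut : ∀ {S j} → SubTransversal cls S → ClassDisjoint cls S j →
                                 TransversalBut (completeBut S j) j
    completeBut-transversalBut {S} {j} subS disjS = sub , disj , cover
      where
      ∈⁻ : ∀ {x} → x ∈ completeBut S j → x ∈ S ⊎ Missing S j x
      ∈⁻ {x} x∈ with x∈p∪q⁻ S _ x∈
      ... | inj₁ x∈S = inj₁ x∈S
      ... | inj₂ x∈M = inj₂ (T-does⁻ (missing? S j x) (x∈tabulate⁻ _ x∈M))
      sub : SubTransversal cls (completeBut S j)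
      sub u v u∈ v∈ cu≡cv with ∈⁻ u∈ | ∈⁻ v∈
      ... | inj₁ u∈S | inj₁ v∈S = subS u v u∈S v∈S cu≡cv
      ... | inj₁ u∈S | inj₂ (_ , disjv , _) = contradiction cu≡cv (disjv u u∈S)
      ... | inj₂ (_ , disju , _) | inj₁ v∈S = contradiction (sym cu≡cv) (disju v v∈S)
      ... | inj₂ (_ , _ , u≡rep) | inj₂ (_ , _ , v≡rep) = trans u≡rep (trans (cong rep cu≡cv) (sym v≡rep))
      disj : ClassDisjoint cls (completeBut S j) j
      disj u u∈ with ∈⁻ u∈
      ... | inj₁ u∈S = disjS u u∈S
      ... | inj₂ (cu≢j , _) = cu≢j
      cover : ∀ j′ → j′ ≢ j → ∃ λ x → x ∈ completeBut S j × cls x ≡ j′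
      cover j′ j′≢j with any? (λ y → (y ∈? S) ×-dec (cls y ≟ᶠ j′))
      ... | yes (y , y∈S , cy≡j′) = y , completeBut-⊇ S j y∈S , cy≡j′
      ... | no  ∄y = rep j′ , x∈p∪q⁺ (inj₂ (x∈tabulate⁺ _ (T-does⁺ (missing? S j (rep j′)) missing))) , cls-rep j′
        where
        missing : Missing S j (rep j′)
        missing = subst (_≢ j) (sym (cls-rep j′)) j′≢j ,
                  subst (ClassDisjoint cls S) (sym (cls-rep j′)) (λ y y∈S cy≡j′ → ∄y (y , y∈S , cy≡j′)) ,
                  cong rep (sym (cls-rep j′))

module Characterisation {cls : Fin n → Fin k} (surj : Surjective cls) (Z : SemiMultimatroid cls) where
  open SemiMultimatroid Z
  open Spanning Z
  open SkewClasses cls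

  UniqueIn : Fin k → (Fin n → Set) → Set
  UniqueIn j P = ∀ x y → cls x ≡ j → cls y ≡ j → P x → P y → x ≡ y

  uniqueIn-map : ∀ {j} {P Q : Fin n → Set} → (∀ {x} → cls x ≡ j → P x → Q x) → UniqueIn j Q → UniqueIn j P
  uniqueIn-map P⇒Q unique x y cx cy px py = unique x y cx cy (P⇒Q cx px) (P⇒Q cy py)

  multimatroid⇒spans-unique : IsMultimatroid Z → ∀ {S j} → SubTransversal cls S → ClassDisjoint cls S j →
                              UniqueIn j (Spans S)
  multimatroid⇒spans-unique multi {S} subS disjS x y cx≡j cy≡j
                            (Cx , (cCx , Cx⊆) , x∈Cx) (Cy , (cCy , Cy⊆) , y∈Cy) with x ≟ᶠ y
  ... | yes x≡y = x≡y
  ... | no  x≢y = ⊥-elim (multi Cx Cy cCx cCy (x , y , xyPair , onlyPair))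
    where
    xyPair : SkewPairIn cls (Cx ∪ Cy) x y
    xyPair = x≢y , trans cx≡j (sym cy≡j) , x∈p∪q⁺ (inj₁ x∈Cx) , x∈p∪q⁺ (inj₂ y∈Cy)
    mem : ∀ {u} → u ∈ Cx ∪ Cy → u ∈ S ⊎ u ≡ x ⊎ u ≡ y
    mem {u} u∈ with x∈p∪q⁻ Cx Cy u∈
    ... | inj₁ u∈Cx = map₂ inj₁ (x∈p∪⁅y⁆⁻ S (Cx⊆ u∈Cx))
    ... | inj₂ u∈Cy = map₂ inj₂ (x∈p∪⁅y⁆⁻ S (Cy⊆ u∈Cy))
    onlyPair : ∀ u v → SkewPairIn cls (Cx ∪ Cy) u v → (u ≡ x × v ≡ y) ⊎ (u ≡ y × v ≡ x)
    onlyPair u v (u≢v , cu≡cv , u∈ , v∈) with mem u∈ | mem v∈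
    ... | inj₁ u∈S        | inj₁ v∈S        = contradiction (subS u v u∈S v∈S cu≡cv) u≢v
    ... | inj₁ u∈S        | inj₂ (inj₁ refl) = contradiction (trans cu≡cv cx≡j) (disjS u u∈S)
    ... | inj₁ u∈S        | inj₂ (inj₂ refl) = contradiction (trans cu≡cv cy≡j) (disjS u u∈S)
    ... | inj₂ (inj₁ refl) | inj₁ v∈S        = contradiction (trans (sym cu≡cv) cx≡j) (disjS v v∈S)
    ... | inj₂ (inj₂ refl) | inj₁ v∈S        = contradiction (trans (sym cu≡cv) cy≡j) (disjS v v∈S)
    ... | inj₂ (inj₁ refl) | inj₂ (inj₁ refl) = contradiction refl u≢v
    ... | inj₂ (inj₂ refl) | inj₂ (inj₂ refl) = contradiction refl u≢v
    ... | inj₂ (inj₁ refl) | inj₂ (inj₂ refl) = inj₁ (refl , refl)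
    ... | inj₂ (inj₂ refl) | inj₂ (inj₁ refl) = inj₂ (refl , refl)

  exactlyOneSkewPair⇒spans-two : ∀ C₁ C₂ → circuit C₁ ≡ true → circuit C₂ ≡ true → ExactlyOneSkewPair cls (C₁ ∪ C₂) →
                                 ∃ λ S → ∃₂ λ x y → SubTransversal cls S × ClassDisjoint cls S (cls x) ×
                                                    cls y ≡ cls x × x ≢ y × Spans S x × Spans S y
  exactlyOneSkewPair⇒spans-two C₁ C₂ c₁ c₂ (x , y , (x≢y , cx≡cy , x∈U , y∈U) , onlyPair) =
    S , x , y , subS , disjS , sym cx≡cy , x≢y , spansBoth
    where
    U = C₁ ∪ C₂
    S = U - x - y
    S⁻ : ∀ {u} → u ∈ S → u ∈ U × u ≢ x × u ≢ y
    S⁻ u∈S with x∈p-y⁻ (U - x) u∈S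
    ... | u∈U-x , u≢y = proj₁ (x∈p-y⁻ U u∈U-x) , proj₂ (x∈p-y⁻ U u∈U-x) , u≢y
    subS : SubTransversal cls S
    subS u v u∈S v∈S cu≡cv with u ≟ᶠ v
    ... | yes u≡v = u≡v
    ... | no  u≢v with S⁻ u∈S | onlyPair u v (u≢v , cu≡cv , proj₁ (S⁻ u∈S) , proj₁ (S⁻ v∈S))
    ...   | _ , u≢x , _ | inj₁ (u≡x , _) = contradiction u≡x u≢x
    ...   | _ , _ , u≢y | inj₂ (u≡y , _) = contradiction u≡y u≢y
    disjS : ClassDisjoint cls S (cls x)
    disjS u u∈S cu≡cx with S⁻ u∈S
    ... | u∈U , u≢x , u≢y with onlyPair u x (u≢x , cu≡cx , u∈U , x∈U)
    ...   | inj₁ (u≡x , _) = u≢x u≡x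
    ...   | inj₂ (u≡y , _) = u≢y u≡y
    ⊆S∪⁅_⁆ : ∀ z {C} → C ⊆ U → (∀ {u} → u ∈ C → u ≡ x ⊎ u ≡ y → u ≡ z) → C ⊆ S ∪ ⁅ z ⁆
    ⊆S∪⁅ z ⁆ C⊆U only-z {u} u∈C with u ≟ᶠ z
    ... | yes refl = y∈p∪⁅y⁆ S u
    ... | no  u≢z  =
      p⊆p∪⁅y⁆ S (x∈p∧x≢y⇒x∈p-y (x∈p∧x≢y⇒x∈p-y (C⊆U u∈C) (u≢z ∘ only-z u∈C ∘ inj₁))
                                (u≢z ∘ only-z u∈C ∘ inj₂))
    -- circuits are subtransversals, so the circuit through x misses y and vice versa
    spans-via : ∀ {A B} → circuit A ≡ true → circuit B ≡ true → A ⊆ U → B ⊆ U → x ∈ A → y ∈ A ⊎ y ∈ B →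
                Spans S x × Spans S y
    spans-via {A} {B} cA cB A⊆U B⊆U x∈A y∈A⊎B =
      (A , (cA , ⊆S∪⁅ x ⁆ A⊆U λ { u∈A (inj₁ u≡x) → u≡x ; u∈A (inj₂ refl) → contradiction u∈A y∉A }) , x∈A) ,
      (B , (cB , ⊆S∪⁅ y ⁆ B⊆U λ { u∈B (inj₁ refl) → contradiction u∈B x∉B ; u∈B (inj₂ u≡y) → u≡y }) , y∈B)
      where
      y∉A : y ∉ A
      y∉A y∈A = x≢y (circ-sub A cA x y x∈A y∈A cx≡cy)
      y∈B : y ∈ B
      y∈B = [ (λ y∈A → contradiction y∈A y∉A) , id ] y∈A⊎B
      x∉B : x ∉ B
      x∉B x∈B = x≢y (circ-sub B cB x y x∈B y∈B cx≡cy)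
    spansBoth : Spans S x × Spans S y
    spansBoth with x∈p∪q⁻ C₁ C₂ x∈U
    ... | inj₁ x∈C₁ = spans-via c₁ c₂ (p⊆p∪q C₂) (q⊆p∪q C₁ C₂) x∈C₁ (x∈p∪q⁻ C₁ C₂ y∈U)
    ... | inj₂ x∈C₂ = spans-via c₂ c₁ (q⊆p∪q C₁ C₂) (p⊆p∪q C₂) x∈C₂ (swap (x∈p∪q⁻ C₁ C₂ y∈U))

  spans-unique⇒multimatroid : (∀ {X j} → TransversalBut X j → UniqueIn j (Spans X)) → IsMultimatroid Z
  spans-unique⇒multimatroid unique C₁ C₂ c₁ c₂ onePair
    with exactlyOneSkewPair⇒spans-two C₁ C₂ c₁ c₂ onePair
  ... | S , x , y , subS , disjS , cy≡cx , x≢y , spansX , spansY =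
    x≢y (unique (completeBut-transversalBut surj subS disjS) x y refl cy≡cx
                (spans-mono (completeBut-⊇ surj S (cls x)) spansX) (spans-mono (completeBut-⊇ surj S (cls x)) spansY))

  spans⇒nullity-changes : ∀ {X j x} → TransversalBut X j → cls x ≡ j → Spans X x → nullity Z (X ∪ ⁅ x ⁆) ≢ nullity Z X
  spans⇒nullity-changes tX@(_ , disjX , _) cx≡j spans =
    >⇒≢ (nullity-∪⁅⁆-spanned (transversalBut-∪⁅⁆ tX cx≡j) id (classDisjoint⇒∉ disjX cx≡j) spans)

  nullity-changes⇒spans : ∀ {S j x} → SubTransversal cls S → ClassDisjoint cls S j → cls x ≡ j →
                          nullity Z (S ∪ ⁅ x ⁆) ≢ nullity Z S → Spans S x
  nullity-changes⇒spans {S} {j} {x} subS disjS cx≡j changes with spans? S x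
  ... | yes spans = spans
  ... | no ¬spans = contradiction (nullity-∪⁅⁆-unspanned ind⊥ (classDisjoint⇒∉ disjS cx≡j) ¬spans) changes
    where
    ind⊥ = independent-⊥ (transversalBut-∪⁅⁆ (completeBut-transversalBut surj subS disjS) cx≡j)

  minorCircuit⇒singleton : ∀ {X j D} → ClassDisjoint cls X j → (∀ j′ → ClassDisjoint cls X j′ → j′ ≡ j) →
                           MinorCircuit Z X D → ∃ λ y → cls y ≡ j × D ≡ ⁅ y ⁆ × Spans X y
  minorCircuit⇒singleton {X} {j} {D} disjX only-j (subD , disjD , _ , _ , (y , y∈D) , (C , (cC , _) , D≡C─X) , _) =
    y , cy≡j , D≡y , C , (cC , C⊆X∪y) , proj₁ (x∈p─q⁻ C X (subst (y ∈_) D≡C─X y∈D))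
    where
    -- D lies in the only class j missed by X and is a subtransversal, hence a singleton
    cy≡j = only-j (cls y) (disjD y y∈D)
    D≡y : D ≡ ⁅ y ⁆
    D≡y = p≡⁅x⁆ y∈D λ {u} u∈D → subD u y u∈D y∈D (trans (only-j (cls u) (disjD u u∈D)) (sym cy≡j))
    C⊆X∪y : C ⊆ X ∪ ⁅ y ⁆
    C⊆X∪y {u} u∈C with u ∈? X
    ... | yes u∈X = p⊆p∪⁅y⁆ X u∈X
    ... | no  u∉X = x∈p∪q⁺ (inj₂ (subst (u ∈_) D≡y (subst (u ∈_) (sym D≡C─X) (x∈p∧x∉q⇒x∈p─q u∈C u∉X))))

  spans⇒minorCircuit : ∀ {X j a} → TransversalBut X j → cls a ≡ j → Spans X a → MinorCircuit Z X ⁅ a ⁆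
  spans⇒minorCircuit {X} {j} {a} tX@(_ , disjX , _) ca≡j (C , (cC , C⊆X∪a) , a∈C) =
    subA , disjA , ⁅ a ⁆ , (disjA , subA , λ j′ disj′ → a , x∈⁅x⁆ a , trans ca≡j (sym (only-j j′ disj′))) ,
    (a , x∈⁅x⁆ a) , (C , (cC , C⊆a∪X) , a≡C─X) , minimal
    where
    only-j = proj₂ (proj₂ (transversalBut⇒minorOrderOne Z tX))
    subA : SubTransversal cls ⁅ a ⁆
    subA u v u∈ v∈ _ = trans (x∈⁅y⁆⇒x≡y a u∈) (sym (x∈⁅y⁆⇒x≡y a v∈))
    disjA : ∀ u → u ∈ ⁅ a ⁆ → ClassDisjoint cls X (cls u)
    disjA u u∈ rewrite x∈⁅y⁆⇒x≡y a u∈ | ca≡j = disjX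
    C⊆a∪X : C ⊆ ⁅ a ⁆ ∪ X
    C⊆a∪X {u} u∈C = subst (u ∈_) (∪-comm X ⁅ a ⁆) (C⊆X∪a u∈C)
    C─X⊆a : C ─ X ⊆ ⁅ a ⁆
    C─X⊆a u∈C─X with x∈p─q⁻ C X u∈C─X
    ... | u∈C , u∉X with x∈p∪⁅y⁆⁻ X (C⊆X∪a u∈C)
    ...   | inj₁ u∈X = contradiction u∈X u∉X
    ...   | inj₂ refl = x∈⁅x⁆ a
    a≡C─X : ⁅ a ⁆ ≡ C ─ X
    a≡C─X = sym (p≡⁅x⁆ (x∈p∧x∉q⇒x∈p─q a∈C (classDisjoint⇒∉ disjX ca≡j)) λ u∈ → x∈⁅y⁆⇒x≡y a (C─X⊆a u∈))
    minimal : ∀ C′ → CircOf Z (⁅ a ⁆ ∪ X) C′ → Nonempty (C′ ─ X) → C′ ─ X ⊆ ⁅ a ⁆ → C′ ─ X ≡ ⁅ a ⁆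
    minimal C′ _ (u , u∈) C′─X⊆a =
      p≡⁅x⁆ (subst (_∈ C′ ─ X) (x∈⁅y⁆⇒x≡y a (C′─X⊆a u∈)) u∈) λ v∈ → x∈⁅y⁆⇒x≡y a (C′─X⊆a v∈)

  UniqueCircuitChange UniqueNullityChange UniqueNullityChangeAtCorankOne AtMostOneCircuitInOrderOneMinors : Set
  UniqueCircuitChange = ∀ S → SubTransversal cls S → ∀ j → ClassDisjoint cls S j → UniqueIn j (CircuitsDiffer Z S)
  UniqueNullityChange = ∀ S → SubTransversal cls S → ∀ j → ClassDisjoint cls S j →
                        UniqueIn j (λ x → nullity Z (S ∪ ⁅ x ⁆) ≢ nullity Z S)
  UniqueNullityChangeAtCorankOne = ∀ S → SubTransversal cls S → ∣ S ∣ + 1 ≡ k → ∀ j → ClassDisjoint cls S j →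
                                   UniqueIn j (λ x → nullity Z (S ∪ ⁅ x ⁆) ≢ nullity Z S)
  AtMostOneCircuitInOrderOneMinors = ∀ X → SubTransversal cls X → MinorOrderOne Z X →
                                     ∀ D₁ D₂ → MinorCircuit Z X D₁ → MinorCircuit Z X D₂ → D₁ ≡ D₂

  multimatroid⇒uniqueCircuitChange : IsMultimatroid Z → UniqueCircuitChange
  multimatroid⇒uniqueCircuitChange multi S subS j disjS =
    uniqueIn-map (λ cx≡j → Equivalence.to (circuitsDiffer⇔spans (classDisjoint⇒∉ disjS cx≡j)))
                 (multimatroid⇒spans-unique multi subS disjS)

  uniqueCircuitChange⇒multimatroid : UniqueCircuitChange → IsMultimatroid Z
  uniqueCircuitChange⇒multimatroid unique = spans-unique⇒multimatroid λ {X} {j} (subX , disjX , _) →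
    uniqueIn-map (λ cx≡j → Equivalence.from (circuitsDiffer⇔spans (classDisjoint⇒∉ disjX cx≡j))) (unique X subX j disjX)

  multimatroid⇒uniqueNullityChange : IsMultimatroid Z → UniqueNullityChange
  multimatroid⇒uniqueNullityChange multi S subS j disjS =
    uniqueIn-map (nullity-changes⇒spans subS disjS) (multimatroid⇒spans-unique multi subS disjS)

  uniqueNullityChange⇒atCorankOne : UniqueNullityChange → UniqueNullityChangeAtCorankOne
  uniqueNullityChange⇒atCorankOne unique S subS _ = unique S subS

  uniqueNullityChangeAtCorankOne⇒multimatroid : UniqueNullityChangeAtCorankOne → IsMultimatroid Z
  uniqueNullityChangeAtCorankOne⇒multimatroid unique =
    spans-unique⇒multimatroid λ {X} {j} tX@(subX , disjX , _) x y cx≡j →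
      uniqueIn-map (spans⇒nullity-changes tX) (unique X subX (transversalBut-size tX cx≡j) j disjX) x y cx≡j

  multimatroid⇒atMostOneCircuit : IsMultimatroid Z → AtMostOneCircuitInOrderOneMinors
  multimatroid⇒atMostOneCircuit multi X subX (j , disjX , only-j) D₁ D₂ m₁ m₂
    with minorCircuit⇒singleton disjX only-j m₁ | minorCircuit⇒singleton disjX only-j m₂
  ... | y₁ , cy₁≡j , D₁≡y₁ , spans₁ | y₂ , cy₂≡j , D₂≡y₂ , spans₂ =
    trans D₁≡y₁ (trans (cong ⁅_⁆ y₁≡y₂) (sym D₂≡y₂))
    where y₁≡y₂ = multimatroid⇒spans-unique multi subX disjX y₁ y₂ cy₁≡j cy₂≡j spans₁ spans₂

  atMostOneCircuit⇒multimatroid : AtMostOneCircuitInOrderOneMinors → IsMultimatroid Z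
  atMostOneCircuit⇒multimatroid unique = spans-unique⇒multimatroid λ {X} tX@(subX , _) x y cx≡j cy≡j spansX spansY →
    ⁅⁆-injective (unique X subX (transversalBut⇒minorOrderOne Z tX) ⁅ x ⁆ ⁅ y ⁆
                         (spans⇒minorCircuit tX cx≡j spansX) (spans⇒minorCircuit tX cy≡j spansY))

mainTheorem15 : ∀ {n k : ℕ} (cls : Fin n → Fin k) → Surjective cls →
    (Z : SemiMultimatroid cls) →
    (IsMultimatroid Z ⇔
      (∀ S → SubTransversal cls S → ∀ j → ClassDisjoint cls S j →
        ∀ x y → cls x ≡ j → cls y ≡ j →
        CircuitsDiffer Z S x → CircuitsDiffer Z S y → x ≡ y))
    ×
    (IsMultimatroid Z ⇔
      (∀ S → SubTransversal cls S → ∀ j → ClassDisjoint cls S j →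
        ∀ x y → cls x ≡ j → cls y ≡ j →
        nullity Z (S ∪ ⁅ x ⁆) ≢ nullity Z S →
        nullity Z (S ∪ ⁅ y ⁆) ≢ nullity Z S → x ≡ y))
    ×
    (IsMultimatroid Z ⇔
      (∀ S → SubTransversal cls S → ∣ S ∣ + 1 ≡ k →
        ∀ j → ClassDisjoint cls S j →
        ∀ x y → cls x ≡ j → cls y ≡ j →
        nullity Z (S ∪ ⁅ x ⁆) ≢ nullity Z S →
        nullity Z (S ∪ ⁅ y ⁆) ≢ nullity Z S → x ≡ y))
    ×
    (IsMultimatroid Z ⇔
      (∀ X → SubTransversal cls X → MinorOrderOne Z X →
        ∀ D₁ D₂ → MinorCircuit Z X D₁ → MinorCircuit Z X D₂ → D₁ ≡ D₂))
mainTheorem15 cls surj Z =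
  mk⇔ multimatroid⇒uniqueCircuitChange uniqueCircuitChange⇒multimatroid ,
  mk⇔ multimatroid⇒uniqueNullityChange (uniqueNullityChangeAtCorankOne⇒multimatroid ∘ uniqueNullityChange⇒atCorankOne) ,
  mk⇔ (uniqueNullityChange⇒atCorankOne ∘ multimatroid⇒uniqueNullityChange) uniqueNullityChangeAtCorankOne⇒multimatroid ,
  mk⇔ multimatroid⇒atMostOneCircuit atMostOneCircuit⇒multimatroid
  where open Characterisation surj Z
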